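{- Let $M=(a_{i,j})_{1\leq i,j\leq n}$ be a Steinhaus matrix of size $n\geq2$. Then, for all $1\leq i<j\leq n$, in $\mathbb{F}_2$, $$ a_{i,j} = \sum_{k=0}^{i-1}{\binom{i-1}{k}a_{1,j-k}} = \sum_{k=0}^{n-j}{\binom{n-j}{k}a_{i+k,n}} = \sum_{k=0}^{j-i-1}{\binom{j-i-1}{k}a_{i+k,i+k+1}}. $$
   Context: A Steinhaus matrix of size $n\geq1$ is a matrix $M=(a_{i,j})_{1\leq i,j\leq n}$ with entries in $\mathbb{F}_2=\{0,1\}$ such that $a_{i,i}=0$ for all $i$, $a_{i,j}=a_{i-1,j-1}+a_{i-1,j}$ (addition in $\mathbb{F}_2$) for all $2\leq i<j\leq n$, and $a_{i,j}=a_{j,i}$ for all $i,j$. -}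

module Defs where

open import Data.Bool using (Bool; true; false; _xor_; _∧_)
open import Data.Nat using (ℕ; zero; suc; _+_; _∸_; _≤_; _<_; _%_; _≡ᵇ_)
open import Data.Nat.Combinatorics using (_C_)
open import Relation.Binary.PropositionalEquality using (_≡_)

-- Matrices over F₂ = Bool (addition = xor, multiplication = ∧).
-- A square matrix of size n is represented by a function a : ℕ → ℕ → Bool
-- with 1-based indices; only the entries a i j with 1 ≤ i, j ≤ n matter
-- (all conditions below only constrain/use those entries).
Matrix : Set
Matrix = ℕ → ℕ → Bool

record IsSteinhaus (n : ℕ) (a : Matrix) : Set where
  field
    diag : ∀ i → 1 ≤ i → i ≤ n → a i i ≡ false
    rule : ∀ i j → 2 ≤ i → i < j → j ≤ n →
           a i j ≡ (a (i ∸ 1) (j ∸ 1) xor a (i ∸ 1) j)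
    symm : ∀ i j → 1 ≤ i → i ≤ n → 1 ≤ j → j ≤ n → a i j ≡ a j i

_·₂_ : ℕ → Bool → Bool
c ·₂ b = (c % 2 ≡ᵇ 1) ∧ b

Σ₂[0…_] : ℕ → (ℕ → Bool) → Bool
Σ₂[0… zero ] f = f 0
Σ₂[0… suc m ] f = Σ₂[0… m ] f xor f (suc m)

-- Over F₂ the Steinhaus rule a(i+1,j+1) = a(i,j) + a(i,j+1) is Pascal's rule, and it can
-- be solved for any one of its three entries. Unrolling it upwards to the first row,
-- rightwards to the last column, or towards the superdiagonal expresses a(i,j) as a binomial
-- transform B(m,g) = Σₖ C(m,k) g(k) of a line of the matrix, because such transforms obey the
-- same recurrence B(m+1,g) = B(m,g) + B(m,g∘suc).
module Submission where

open import Defs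
open import Algebra.Bundles using (CommutativeRing)
open import Data.Bool using (Bool; true; false; _xor_; _∧_)
open import Data.Bool.Properties
  using (xor-∧-commutativeRing; xor-comm; xor-assoc; xor-same; xor-identityʳ; ∧-distribʳ-xor)
open import Data.Nat using (ℕ; zero; suc; _+_; _∸_; _≤_; _<_; _%_; _≡ᵇ_; s≤s; z≤n)
open import Data.Nat.Properties
  using (+-suc; +-identityʳ; m+[n∸m]≡n; ≤-trans; n≤1+n; n<1+n; m≤m+n; m<m+n)
open import Data.Nat.Combinatorics using (_C_; nCk+nC[k+1]≡[n+1]C[k+1]; k>n⇒nCk≡0)
open import Data.Product using (_×_; _,_)
open import Function using (_∘_)
open import Relation.Binary.PropositionalEquality
  using (_≡_; refl; sym; trans; cong; cong₂; subst; module ≡-Reasoning)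

open import Algebra.Properties.CommutativeSemigroup
  (CommutativeRing.+-commutativeSemigroup xor-∧-commutativeRing)
  using (interchange; x∙yz≈xz∙y)

isOdd : ℕ → Bool
isOdd c = c % 2 ≡ᵇ 1

isOdd-+ : ∀ x y → isOdd (x + y) ≡ isOdd x xor isOdd y
isOdd-+ zero          y = refl
isOdd-+ (suc zero)    y = isOdd-suc y
  where
  isOdd-suc : ∀ y → isOdd (suc y) ≡ true xor isOdd y
  isOdd-suc zero          = refl
  isOdd-suc (suc zero)    = refl
  isOdd-suc (suc (suc y)) = isOdd-suc y
isOdd-+ (suc (suc x)) y = isOdd-+ x y

·₂-distribʳ-+ : ∀ x y b → (x + y) ·₂ b ≡ (x ·₂ b) xor (y ·₂ b)
·₂-distribʳ-+ x y b = trans (cong (_∧ b) (isOdd-+ x y)) (∧-distribʳ-xor b (isOdd x) (isOdd y))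

xor-solveˡ : ∀ {x y z} → x ≡ y xor z → y ≡ x xor z
xor-solveˡ {x} {y} {z} x≡y+z = sym (begin
  x xor z         ≡⟨ cong (_xor z) x≡y+z ⟩
  (y xor z) xor z ≡⟨ xor-assoc y z z ⟩
  y xor (z xor z) ≡⟨ cong (y xor_) (xor-same z) ⟩
  y xor false     ≡⟨ xor-identityʳ y ⟩
  y               ∎)
  where open ≡-Reasoning

xor-solveʳ : ∀ {x y z} → x ≡ y xor z → z ≡ y xor x
xor-solveʳ {x} {y} {z} x≡y+z = trans (xor-solveˡ (trans x≡y+z (xor-comm y z))) (xor-comm x y)

Σ₂-cong : ∀ m {f g : ℕ → Bool} → (∀ k → f k ≡ g k) → Σ₂[0… m ] f ≡ Σ₂[0… m ] g
Σ₂-cong zero    f≗g = f≗g 0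
Σ₂-cong (suc m) f≗g = cong₂ _xor_ (Σ₂-cong m f≗g) (f≗g (suc m))

Σ₂-distrib-xor : ∀ m (f g : ℕ → Bool) →
                 Σ₂[0… m ] (λ k → f k xor g k) ≡ Σ₂[0… m ] f xor Σ₂[0… m ] g
Σ₂-distrib-xor zero    f g = refl
Σ₂-distrib-xor (suc m) f g =
  trans (cong (_xor (f (suc m) xor g (suc m))) (Σ₂-distrib-xor m f g))
        (interchange (Σ₂[0… m ] f) (Σ₂[0… m ] g) (f (suc m)) (g (suc m)))

Σ₂-unconsˡ : ∀ m (f : ℕ → Bool) → Σ₂[0… suc m ] f ≡ f 0 xor Σ₂[0… m ] (f ∘ suc)
Σ₂-unconsˡ zero    f = refl
Σ₂-unconsˡ (suc m) f =
  trans (cong (_xor f (suc (suc m))) (Σ₂-unconsˡ m f)) (xor-assoc (f 0) _ _)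

binomialTransform : ℕ → (ℕ → Bool) → Bool
binomialTransform m g = Σ₂[0… m ] (λ k → (m C k) ·₂ g k)

binomialTransform-extend : ∀ m g → Σ₂[0… suc m ] (λ k → (m C k) ·₂ g k) ≡ binomialTransform m g
binomialTransform-extend m g =
  trans (cong (λ c → binomialTransform m g xor (c ·₂ g (suc m))) (k>n⇒nCk≡0 (n<1+n m)))
        (xor-identityʳ (binomialTransform m g))

binomialTransform-suc : ∀ m g →
  binomialTransform (suc m) g ≡ binomialTransform m g xor binomialTransform m (g ∘ suc)
binomialTransform-suc m g = begin
  binomialTransform (suc m) g
    ≡⟨ Σ₂-unconsˡ m _ ⟩
  g 0 xor Σ₂[0… m ] (λ k → (suc m C suc k) ·₂ g (suc k))
    ≡⟨ cong (g 0 xor_) (Σ₂-cong m pascal) ⟩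
  g 0 xor Σ₂[0… m ] (λ k → ((m C k) ·₂ g (suc k)) xor ((m C suc k) ·₂ g (suc k)))
    ≡⟨ cong (g 0 xor_) (Σ₂-distrib-xor m _ _) ⟩
  g 0 xor (binomialTransform m (g ∘ suc) xor Σ₂[0… m ] (λ k → (m C suc k) ·₂ g (suc k)))
    ≡⟨ x∙yz≈xz∙y (g 0) _ _ ⟩
  (g 0 xor Σ₂[0… m ] (λ k → (m C suc k) ·₂ g (suc k))) xor binomialTransform m (g ∘ suc)
    ≡⟨ cong (_xor binomialTransform m (g ∘ suc)) (sym (Σ₂-unconsˡ m _)) ⟩
  Σ₂[0… suc m ] (λ k → (m C k) ·₂ g k) xor binomialTransform m (g ∘ suc)
    ≡⟨ cong (_xor binomialTransform m (g ∘ suc)) (binomialTransform-extend m g) ⟩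
  binomialTransform m g xor binomialTransform m (g ∘ suc)
    ∎
  where
  open ≡-Reasoning
  pascal : ∀ k → (suc m C suc k) ·₂ g (suc k)
                 ≡ ((m C k) ·₂ g (suc k)) xor ((m C suc k) ·₂ g (suc k))
  pascal k = trans (cong (_·₂ g (suc k)) (sym (nCk+nC[k+1]≡[n+1]C[k+1] m k)))
                   (·₂-distribʳ-+ (m C k) (m C suc k) (g (suc k)))

binomialTransform-cong : ∀ m {f g : ℕ → Bool} → (∀ k → f k ≡ g k) →
                         binomialTransform m f ≡ binomialTransform m g
binomialTransform-cong m f≗g = Σ₂-cong m (λ k → cong ((m C k) ·₂_) (f≗g k))

m+[1+[n∸m∸1]]≡n : ∀ m n → m < n → m + suc (n ∸ m ∸ 1) ≡ n
m+[1+[n∸m∸1]]≡n zero    (suc n) _       = refl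
m+[1+[n∸m∸1]]≡n (suc m) (suc n) (s≤s m<n) = cong suc (m+[1+[n∸m∸1]]≡n m n m<n)

module Steinhaus {n : ℕ} {a : Matrix} (S : IsSteinhaus n a) where
  open IsSteinhaus S
  open ≡-Reasoning

  pascal-rule : ∀ {i j} → 1 ≤ i → i < j → suc j ≤ n → a (suc i) (suc j) ≡ a i j xor a i (suc j)
  pascal-rule {i} {j} 1≤i i<j = rule (suc i) (suc j) (s≤s 1≤i) (s≤s i<j)

  from-first-row : ∀ d j → suc d < j → j ≤ n →
                   a (suc d) j ≡ binomialTransform d (λ k → a 1 (j ∸ k))
  from-first-row zero    j       _         _   = refl
  from-first-row (suc d) (suc j) (s≤s d<j) 1+j≤n = begin
    a (suc (suc d)) (suc j)
      ≡⟨ pascal-rule (s≤s z≤n) d<j 1+j≤n ⟩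
    a (suc d) j xor a (suc d) (suc j)
      ≡⟨ cong₂ _xor_ (from-first-row d j d<j (≤-trans (n≤1+n j) 1+j≤n))
                     (from-first-row d (suc j) (≤-trans d<j (n≤1+n j)) 1+j≤n) ⟩
    binomialTransform d (g ∘ suc) xor binomialTransform d g
      ≡⟨ xor-comm (binomialTransform d (g ∘ suc)) (binomialTransform d g) ⟩
    binomialTransform d g xor binomialTransform d (g ∘ suc)
      ≡⟨ sym (binomialTransform-suc d g) ⟩
    binomialTransform (suc d) g
      ∎
    where
    g : ℕ → Bool
    g k = a 1 (suc j ∸ k)

  from-last-column : ∀ e i j → 1 ≤ i → i < j → j + e ≡ n →
                     a i j ≡ binomialTransform e (λ k → a (i + k) n)
  from-last-column zero    i j _   _   j+0≡n =
    cong₂ a (sym (+-identityʳ i)) (trans (sym (+-identityʳ j)) j+0≡n)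
  from-last-column (suc e) i j 1≤i i<j j+e≡n = begin
    a i j
      ≡⟨ xor-solveˡ (pascal-rule 1≤i i<j 1+j≤n) ⟩
    a (suc i) (suc j) xor a i (suc j)
      ≡⟨ cong₂ _xor_ (from-last-column e (suc i) (suc j) (s≤s z≤n) (s≤s i<j) 1+j+e≡n)
                     (from-last-column e i (suc j) 1≤i (≤-trans i<j (n≤1+n j)) 1+j+e≡n) ⟩
    binomialTransform e (λ k → a (suc i + k) n) xor binomialTransform e g
      ≡⟨ cong (_xor binomialTransform e g)
              (binomialTransform-cong e (λ k → cong (λ r → a r n) (sym (+-suc i k)))) ⟩
    binomialTransform e (g ∘ suc) xor binomialTransform e g
      ≡⟨ xor-comm (binomialTransform e (g ∘ suc)) (binomialTransform e g) ⟩
    binomialTransform e g xor binomialTransform e (g ∘ suc)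
      ≡⟨ sym (binomialTransform-suc e g) ⟩
    binomialTransform (suc e) g
      ∎
    where
    g : ℕ → Bool
    g k = a (i + k) n
    1+j+e≡n : suc j + e ≡ n
    1+j+e≡n = trans (sym (+-suc j e)) j+e≡n
    1+j≤n : suc j ≤ n
    1+j≤n = subst (suc j ≤_) 1+j+e≡n (m≤m+n (suc j) e)

  from-superdiagonal : ∀ d i → 1 ≤ i → i + suc d ≤ n →
                       a i (i + suc d) ≡ binomialTransform d (λ k → a (i + k) (i + k + 1))
  from-superdiagonal zero    i _   _ =
    cong₂ a (sym (+-identityʳ i)) (cong (_+ 1) (sym (+-identityʳ i)))
  from-superdiagonal (suc d) i 1≤i i+2+d≤n = begin
    a i (i + suc (suc d))
      ≡⟨ cong (a i) (+-suc i (suc d)) ⟩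
    a i (suc (i + suc d))
      ≡⟨ xor-solveʳ {y = a i (i + suc d)} (pascal-rule 1≤i (m<m+n i (s≤s z≤n)) 1+i+1+d≤n) ⟩
    a i (i + suc d) xor a (suc i) (suc i + suc d)
      ≡⟨ cong₂ _xor_ (from-superdiagonal d i 1≤i (≤-trans (n≤1+n _) 1+i+1+d≤n))
                     (from-superdiagonal d (suc i) (s≤s z≤n) 1+i+1+d≤n) ⟩
    binomialTransform d f xor binomialTransform d (λ k → a (suc i + k) (suc i + k + 1))
      ≡⟨ cong (binomialTransform d f xor_)
              (binomialTransform-cong d (λ k → cong (λ r → a r (r + 1)) (sym (+-suc i k)))) ⟩
    binomialTransform d f xor binomialTransform d (f ∘ suc)
      ≡⟨ sym (binomialTransform-suc d f) ⟩
    binomialTransform (suc d) f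
      ∎
    where
    f : ℕ → Bool
    f k = a (i + k) (i + k + 1)
    1+i+1+d≤n : suc (i + suc d) ≤ n
    1+i+1+d≤n = subst (_≤ n) (+-suc i (suc d)) i+2+d≤n

lemma1 : (n : ℕ) → 2 ≤ n → (a : Matrix) → IsSteinhaus n a →
    (i j : ℕ) → 1 ≤ i → i < j → j ≤ n →
    (a i j ≡ Σ₂[0… i ∸ 1 ] (λ k → ((i ∸ 1) C k) ·₂ a 1 (j ∸ k)))
    × (a i j ≡ Σ₂[0… n ∸ j ] (λ k → ((n ∸ j) C k) ·₂ a (i + k) n))
    × (a i j ≡ Σ₂[0… j ∸ i ∸ 1 ] (λ k → ((j ∸ i ∸ 1) C k) ·₂ a (i + k) (i + k + 1)))
lemma1 n _ a S (suc d) j 1≤i i<j j≤n =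
    from-first-row d j i<j j≤n
  , from-last-column (n ∸ j) (suc d) j 1≤i i<j (m+[n∸m]≡n j≤n)
  , subst (λ c → a (suc d) c ≡ binomialTransform (j ∸ suc d ∸ 1) (λ k → a (suc d + k) (suc d + k + 1)))
          i+[1+[j∸i∸1]]≡j
          (from-superdiagonal (j ∸ suc d ∸ 1) (suc d) 1≤i (subst (_≤ n) (sym i+[1+[j∸i∸1]]≡j) j≤n))
  where
  open Steinhaus S
  i+[1+[j∸i∸1]]≡j : suc d + suc (j ∸ suc d ∸ 1) ≡ j
  i+[1+[j∸i∸1]]≡j = m+[1+[n∸m∸1]]≡n (suc d) j i<j
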